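{- Let $S=(a_h)_{h\in\mathbb{Z}}$ be a complete folding sequence. Then $S$ is locally isomorphic to $\overline{S}=(-a_{ -h})_{h\in\mathbb{Z}}$, but $S$ is not locally isomorphic to $-S=(-a_h)_{h\in\mathbb{Z}}$.
   Context: All sequences take values in $\{+1,-1\}$. For a finite sequence $(a_1,\dots,a_n)$ write $\overline{(a_1,\dots,a_n)}=(-a_n,\dots,-a_1)$. The $n$-folding sequences are defined recursively: the only $0$-folding sequence is the empty sequence, and the $(n+1)$-folding sequences are exactly $(\overline{U},+1,U)$ and $(\overline{U},-1,U)$ with $U$ an $n$-folding sequence. A finite sequence $(u_1,\dots,u_m)$ is a subword of a sequence $(b_k)$ if there is $h$ with $u_k=b_{k+h}$ for $1\le k\le m$. A complete folding sequence is a sequence $(a_k)_{k\in\mathbb{Z}}$ each finite subword of which is a subword of some $n$-folding sequence. Two sequences indexed by $\mathbb{Z}$ are locally isomorphic if they have the same finite subwords. -}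

module Defs where

open import Data.Nat using (ℕ; zero; suc; _+_; _≤_)
open import Data.Integer using (ℤ; +_; -_) renaming (_+_ to _+ℤ_)
open import Data.List using (List; []; _∷_; _++_; [_]; reverse; map; length; take; drop)
open import Data.Product using (Σ; ∃; _×_; _,_)
open import Relation.Binary.PropositionalEquality using (_≡_)

data Sign : Set where
  plus  : Sign
  minus : Sign

neg : Sign → Sign
neg plus  = minus
neg minus = plus

bar : List Sign → List Sign
bar u = reverse (map neg u)

data Folding : ℕ → List Sign → Set where
  fold-zero : Folding zero []
  fold-suc  : ∀ {n U} → Folding n U → (s : Sign) → Folding (suc n) (bar U ++ s ∷ U)

ZSeq : Set
ZSeq = ℤ → Sign

window : ZSeq → ℤ → ℕ → List Sign
window a h zero    = []
window a h (suc m) = a (h +ℤ + 1) ∷ window a (h +ℤ + 1) m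

SubwordZ : List Sign → ZSeq → Set
SubwordZ u a = ∃ λ (h : ℤ) → window a h (length u) ≡ u

SubwordL : List Sign → List Sign → Set
SubwordL u b = ∃ λ (h : ℕ) → (h + length u ≤ length b) × (take (length u) (drop h b) ≡ u)

CompleteFolding : ZSeq → Set
CompleteFolding a = ∀ (u : List Sign) → SubwordZ u a →
  ∃ λ (n : ℕ) → ∃ λ (U : List Sign) → Folding n U × SubwordL u U

LocallyIsomorphic : ZSeq → ZSeq → Set
LocallyIsomorphic a b = ∀ (u : List Sign) → (SubwordZ u a → SubwordZ u b) × (SubwordZ u b → SubwordZ u a)

barZ : ZSeq → ZSeq
barZ a h = neg (a (- h))

negZ : ZSeq → ZSeq
negZ a h = neg (a h)

module Submission where

-- The argument works with paperfolding sequences.  A sequence of fold choices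
-- g : ℕ → Sign determines the sign sequence  paper g  on the positions 1, 2, 3, …:
-- odd positions 2k+1 carry the alternating signs (-1)^k · g 0, and the even
-- positions 2k repeat, at position k, the paperfolding sequence of the remaining
-- choices g 1, g 2, ….  Every n-folding sequence is an initial segment of such a
-- sequence (folding-segment), so every window of a complete folding sequence S is a
-- segment of some paperfolding sequence (window-in-paper).
--
-- Two local facts about paperfolding sequences then give the theorem.
--  * Mirror symmetry (overline-near): around every multiple M of 2^k the signs are
--    antisymmetric at distance below 2^k (reflection), positions off the multiples
--    of 2^k are 2^(k+1)-periodic (periodicity), and one of M + 2^(k+1)·w, w ≤ 3,
--    carries the sign opposite to M (opposite-at-multiple).  Hence the overline of
--    every segment of length L occurs within distance 8·2^L, which makes the
--    subwords of S closed under overline and S locally isomorphic to S̄.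
--  * No antipodal pairs (no-antipodal-pair): no segment of length 14 occurs
--    together with its negative, by descending through the levels of folds until
--    four consecutive alternating signs would be forced.  The window of S of
--    length 14 at the origin is therefore not a subword of -S.

open import Defs
open import Data.Nat using (ℕ; zero; suc; _+_; _*_; _^_; _≤_; _<_; z≤n; s≤s; ⌊_/2⌋; NonZero)
open import Data.Nat.Base using (parity)
open import Data.Nat.Properties
open import Data.Nat.DivMod using (_/_; _%_; m≡m%n+[m/n]*n; m%n<n)
open import Data.Nat.Tactic.RingSolver using (solve-∀)
open import Data.Parity.Base using (Parity; 0ℙ; 1ℙ)
open import Data.Integer using (+_; -[1+_]; -_) renaming (_+_ to _+ℤ_; _-_ to _-ℤ_)
import Data.Integer.Properties as ℤ
open import Data.Integer.Tactic.RingSolver renaming (solve-∀ to ℤ-solve-∀)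
open import Data.List using (List; []; _∷_; _++_; [_]; reverse; map; length; take; drop)
open import Data.List.Properties
  using (map-++; reverse-++; unfold-reverse; ++-assoc; length-++; length-map; length-reverse;
         reverse-map; reverse-involutive; ∷-injectiveˡ; ∷-injectiveʳ)
open import Data.Empty using (⊥; ⊥-elim)
open import Data.Product using (∃; ∃₂; _×_; _,_; proj₁; proj₂)
open import Data.Sum using (_⊎_; inj₁; inj₂)
open import Function using (_∘_)
open import Relation.Binary.Definitions using (tri<; tri≈; tri>)
open import Relation.Binary.PropositionalEquality hiding ([_])
open import Relation.Nullary using (¬_)

neg-involutive : ∀ s → neg (neg s) ≡ s
neg-involutive plus  = refl
neg-involutive minus = refl

s≢neg-s : ∀ {s} → s ≡ neg s → ⊥
s≢neg-s {plus}  ()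
s≢neg-s {minus} ()

neg-swap : ∀ {a b} → a ≡ neg b → b ≡ neg a
neg-swap {a} {b} e = trans (sym (neg-involutive b)) (cong neg (sym e))

sign-cases : ∀ a b → a ≡ b ⊎ a ≡ neg b
sign-cases plus  plus  = inj₁ refl
sign-cases plus  minus = inj₂ refl
sign-cases minus plus  = inj₂ refl
sign-cases minus minus = inj₁ refl

alternate : Sign → ℕ → Sign
alternate c zero    = c
alternate c (suc i) = neg (alternate c i)

alternate-neg : ∀ c i → alternate (neg c) i ≡ neg (alternate c i)
alternate-neg c zero    = refl
alternate-neg c (suc i) = cong neg (alternate-neg c i)

alternate-+ : ∀ c m n → alternate c (m + n) ≡ alternate (alternate c m) n
alternate-+ c zero    n = refl
alternate-+ c (suc m) n = trans (cong neg (alternate-+ c m n)) (sym (alternate-neg (alternate c m) n))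

alternate-double : ∀ c n → alternate c (n + n) ≡ c
alternate-double c zero    = refl
alternate-double c (suc n) rewrite +-suc n n =
  trans (neg-involutive (alternate c (n + n))) (alternate-double c n)

alternate-odd : ∀ c n → alternate c (suc (n + n)) ≡ neg c
alternate-odd c n = cong neg (alternate-double c n)

data EvenOdd : ℕ → Set where
  even : ∀ k → EvenOdd (k + k)
  odd  : ∀ k → EvenOdd (suc (k + k))

evenOdd : ∀ n → EvenOdd n
evenOdd zero    = even zero
evenOdd (suc n) with evenOdd n
... | even k = odd k
... | odd k  = subst EvenOdd (cong suc (+-suc k k)) (even (suc k))

parity-even : ∀ k → parity (k + k) ≡ 0ℙ
parity-even zero    = refl
parity-even (suc k) rewrite +-suc k k = parity-even k

parity-odd : ∀ k → parity (suc (k + k)) ≡ 1ℙ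
parity-odd zero    = refl
parity-odd (suc k) rewrite +-suc k k = parity-odd k

half-odd : ∀ k → ⌊ suc (k + k) /2⌋ ≡ k
half-odd zero    = refl
half-odd (suc k) rewrite +-suc k k = cong suc (half-odd k)

double≢odd : ∀ m n → m + m ≡ suc (n + n) → ⊥
double≢odd m n e with trans (sym (parity-even m)) (trans (cong parity e) (parity-odd n))
... | ()

double-injective : ∀ m n → m + m ≡ n + n → m ≡ n
double-injective m n e = trans (n≡⌊n+n/2⌋ m) (trans (cong ⌊_/2⌋ e) (sym (n≡⌊n+n/2⌋ n)))

double-<-cancel : ∀ {m n} → m + m < n + n → m < n
double-<-cancel lt = ≰⇒> (λ n≤m → <⇒≱ lt (+-mono-≤ n≤m n≤m))

half-positive : ∀ {n} → 0 < n + n → 0 < n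
half-positive {suc n} _ = s≤s z≤n

double-multiple : ∀ Q P → Q * (2 * P) ≡ Q * P + Q * P
double-multiple = solve-∀

pow-suc : ∀ k → 2 ^ suc k ≡ 2 ^ k + 2 ^ k
pow-suc k = cong (λ n → 2 ^ k + n) (+-identityʳ (2 ^ k))

n<2^n : ∀ n → n < 2 ^ n
n<2^n zero    = s≤s z≤n
n<2^n (suc n) = ≤-trans (≤-reflexive (+-comm 1 (suc n)))
                        (≤-trans (+-mono-≤ (n<2^n n) (m^n>0 2 n)) (≤-reflexive (sym (pow-suc n))))

tail : (ℕ → Sign) → (ℕ → Sign)
tail g i = g (suc i)

shift : ℕ → (ℕ → Sign) → (ℕ → Sign)
shift k g i = g (k + i)

_◂_ : Sign → (ℕ → Sign) → (ℕ → Sign)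
(c ◂ g) zero    = c
(c ◂ g) (suc i) = g i

byParity : {A : Set} → Parity → A → A → A
byParity 0ℙ whenEven whenOdd = whenEven
byParity 1ℙ whenEven whenOdd = whenOdd

-- Each step halves the position, so d steps of fuel evaluate every position n ≤ d
-- (paperWithin-stable).  Position 0 only carries a dummy value.
paperWithin : ℕ → (ℕ → Sign) → ℕ → Sign
paperWithin zero    g n = plus
paperWithin (suc d) g n =
  byParity (parity n) (paperWithin d (tail g) ⌊ n /2⌋) (alternate (g 0) ⌊ n /2⌋)

half≤pred : ∀ {n d} → n ≤ suc d → ⌊ n /2⌋ ≤ d
half≤pred {zero}  _     = z≤n
half≤pred {suc n} n≤1+d = ≤-pred (≤-trans (⌊n/2⌋<n n) n≤1+d)

paperWithin-stable : ∀ d e g n → n ≤ d → n ≤ e → paperWithin d g n ≡ paperWithin e g n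
paperWithin-stable zero    zero    g n    _   _   = refl
paperWithin-stable zero    (suc e) g zero _   _   = paperWithin-stable zero e (tail g) zero z≤n z≤n
paperWithin-stable (suc d) zero    g zero _   _   = paperWithin-stable d zero (tail g) zero z≤n z≤n
paperWithin-stable (suc d) (suc e) g n    n≤d n≤e with parity n
... | 0ℙ = paperWithin-stable d e (tail g) ⌊ n /2⌋ (half≤pred n≤d) (half≤pred n≤e)
... | 1ℙ = refl

paper : (ℕ → Sign) → ℕ → Sign
paper g n = paperWithin n g n

paper-odd : ∀ g k → paper g (suc (k + k)) ≡ alternate (g 0) k
paper-odd g k rewrite parity-odd k | half-odd k = refl

paper-even : ∀ g k → paper g (k + k) ≡ paper (tail g) k
paper-even g zero    = refl
paper-even g (suc k) rewrite parity-even (suc k) | sym (n≡⌊n+n/2⌋ (suc k)) =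
  paperWithin-stable (k + suc k) (suc k) (tail g) (suc k) (m≤n+m (suc k) k) ≤-refl

paper-descend : ∀ k g n → paper g (n * 2 ^ k) ≡ paper (shift k g) n
paper-descend zero    g n = cong (paper g) (*-identityʳ n)
paper-descend (suc k) g n =
  begin
    paper g (n * (2 * 2 ^ k))       ≡⟨ cong (paper g) (double-multiple n (2 ^ k)) ⟩
    paper g (n * 2 ^ k + n * 2 ^ k) ≡⟨ paper-even g (n * 2 ^ k) ⟩
    paper (tail g) (n * 2 ^ k)      ≡⟨ paper-descend k (tail g) n ⟩
    paper (shift (suc k) g) n       ∎
  where open ≡-Reasoning

antiperiod-odd : ∀ g k → paper g (suc (k + k) + 2) ≡ neg (paper g (suc (k + k)))
antiperiod-odd g k =
  begin
    paper g (suc (k + k) + 2)     ≡⟨ cong (paper g) (shape k) ⟩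
    paper g (suc (suc k + suc k)) ≡⟨ paper-odd g (suc k) ⟩
    neg (alternate (g 0) k)       ≡⟨ cong neg (sym (paper-odd g k)) ⟩
    neg (paper g (suc (k + k)))   ∎
  where
    open ≡-Reasoning
    shape : ∀ k → suc (k + k) + 2 ≡ suc (suc k + suc k)
    shape = solve-∀

antiperiod-twiceOdd : ∀ g k → let m = suc (k + k) in paper g (m + m + 4) ≡ neg (paper g (m + m))
antiperiod-twiceOdd g k =
  begin
    paper g (m + m + 4)          ≡⟨ cong (paper g) (shape m) ⟩
    paper g ((m + 2) + (m + 2))  ≡⟨ paper-even g (m + 2) ⟩
    paper (tail g) (m + 2)       ≡⟨ antiperiod-odd (tail g) k ⟩
    neg (paper (tail g) m)       ≡⟨ cong neg (sym (paper-even g m)) ⟩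
    neg (paper g (m + m))        ∎
  where
    open ≡-Reasoning
    m = suc (k + k)
    shape : ∀ m → m + m + 4 ≡ (m + 2) + (m + 2)
    shape = solve-∀

odd-periodic : ∀ g y n → paper g (suc (y + y) + 4 * n) ≡ paper g (suc (y + y))
odd-periodic g y n =
  begin
    paper g (suc (y + y) + 4 * n)                  ≡⟨ cong (paper g) (shape y n) ⟩
    paper g (suc ((y + (n + n)) + (y + (n + n))))  ≡⟨ paper-odd g (y + (n + n)) ⟩
    alternate (g 0) (y + (n + n))                  ≡⟨ alternate-+ (g 0) y (n + n) ⟩
    alternate (alternate (g 0) y) (n + n)          ≡⟨ alternate-double (alternate (g 0) y) n ⟩
    alternate (g 0) y                              ≡⟨ sym (paper-odd g y) ⟩
    paper g (suc (y + y))                          ∎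
  where
    open ≡-Reasoning
    shape : ∀ y n → suc (y + y) + 4 * n ≡ suc ((y + (n + n)) + (y + (n + n)))
    shape = solve-∀

-- Every position m is followed, at distance 2, 4 or 6, by the opposite sign: odd and twice
-- odd positions by the antiperiods, and a multiple of 4 either at distance 2 or, through
-- the twice odd position m + 2, at distance 6.
opposite-ahead : ∀ g m → ∃ λ w → w ≤ 3 × paper g (m + 2 * w) ≡ neg (paper g m)
opposite-ahead g m with evenOdd m
... | odd k = 1 , s≤s z≤n , antiperiod-odd g k
... | even k with evenOdd k
...   | odd j  = 2 , s≤s (s≤s z≤n) , antiperiod-twiceOdd g j
...   | even j with sign-cases (paper g ((j + j) + (j + j) + 2)) (neg (paper g ((j + j) + (j + j))))
...     | inj₁ flips = 1 , s≤s z≤n , flips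
...     | inj₂ stays = 3 , ≤-refl ,
  (begin
    paper g (n + 6)             ≡⟨ cong (paper g) (shape j) ⟩
    paper g (m′ + m′ + 4)       ≡⟨ antiperiod-twiceOdd g j ⟩
    neg (paper g (m′ + m′))     ≡⟨ cong (λ i → neg (paper g i)) (sym (shape′ j)) ⟩
    neg (paper g (n + 2))       ≡⟨ cong neg (trans stays (neg-involutive (paper g n))) ⟩
    neg (paper g n)             ∎)
  where
    open ≡-Reasoning
    n = (j + j) + (j + j)
    m′ = suc (j + j)
    shape : ∀ j → (j + j) + (j + j) + 6 ≡ suc (j + j) + suc (j + j) + 4
    shape = solve-∀
    shape′ : ∀ j → (j + j) + (j + j) + 2 ≡ suc (j + j) + suc (j + j)
    shape′ = solve-∀

opposite-at-multiple : ∀ k g Q →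
  ∃ λ w → w ≤ 3 × paper g (Q * 2 ^ k + w * 2 ^ suc k) ≡ neg (paper g (Q * 2 ^ k))
opposite-at-multiple k g Q with opposite-ahead (shift k g) Q
... | w , w≤3 , opposite = w , w≤3 ,
  (begin
    paper g (Q * 2 ^ k + w * (2 * 2 ^ k)) ≡⟨ cong (paper g) (shape Q w (2 ^ k)) ⟩
    paper g ((Q + 2 * w) * 2 ^ k)         ≡⟨ paper-descend k g (Q + 2 * w) ⟩
    paper (shift k g) (Q + 2 * w)         ≡⟨ opposite ⟩
    neg (paper (shift k g) Q)             ≡⟨ cong neg (sym (paper-descend k g Q)) ⟩
    neg (paper g (Q * 2 ^ k))             ∎)
  where
    open ≡-Reasoning
    shape : ∀ Q w P → Q * P + w * (2 * P) ≡ (Q + 2 * w) * P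
    shape = solve-∀

-- Level 0 of the reflection: odd positions symmetric about an even centre M + M have
-- opposite signs, since their indices in the alternating sequence differ by an odd number.
reflection-odd : ∀ g M a j → suc (a + a) + suc (j + j) ≡ M + M →
                 paper g (M + M + suc (j + j)) ≡ neg (paper g (suc (a + a)))
reflection-odd g M a j centred =
  begin
    paper g (M + M + suc (j + j))              ≡⟨ cong (paper g) (shape M j) ⟩
    paper g (suc ((M + j) + (M + j)))          ≡⟨ paper-odd g (M + j) ⟩
    alternate (g 0) (M + j)                    ≡⟨ cong (alternate (g 0)) M+j≡a+odd ⟩
    alternate (g 0) (a + suc (j + j))          ≡⟨ alternate-+ (g 0) a (suc (j + j)) ⟩
    alternate (alternate (g 0) a) (suc (j + j)) ≡⟨ alternate-odd (alternate (g 0) a) j ⟩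
    neg (alternate (g 0) a)                    ≡⟨ cong neg (sym (paper-odd g a)) ⟩
    neg (paper g (suc (a + a)))                ∎
  where
    open ≡-Reasoning
    shape : ∀ M j → M + M + suc (j + j) ≡ suc ((M + j) + (M + j))
    shape = solve-∀
    regroup : ∀ a j → suc (a + j) + suc (a + j) ≡ suc (a + a) + suc (j + j)
    regroup = solve-∀
    rearrange : ∀ a j → suc (a + j) + j ≡ a + suc (j + j)
    rearrange = solve-∀
    M+j≡a+odd : M + j ≡ a + suc (j + j)
    M+j≡a+odd = trans (cong (_+ j) (sym (double-injective _ _ (trans (regroup a j) centred)))) (rearrange a j)

reflection : ∀ k g Q a j → 0 < j → j < 2 ^ k → a + j ≡ Q * 2 ^ k →
             paper g (Q * 2 ^ k + j) ≡ neg (paper g a)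
reflection zero g Q a (suc j) _ (s≤s ()) _
reflection (suc k) g Q a j 0<j j<2P a+j≡Q2P
  with evenOdd a | evenOdd j | trans a+j≡Q2P (double-multiple Q (2 ^ k))
... | odd a′ | odd j′ | a+j≡M+M =
  trans (cong (λ n → paper g (n + suc (j′ + j′))) (double-multiple Q (2 ^ k)))
        (reflection-odd g (Q * 2 ^ k) a′ j′ a+j≡M+M)
... | even a′ | even j′ | a+j≡M+M =
  begin
    paper g (Q * (2 * P) + (j′ + j′))  ≡⟨ cong (paper g) (shape Q P j′) ⟩
    paper g ((M + j′) + (M + j′))      ≡⟨ paper-even g (M + j′) ⟩
    paper (tail g) (M + j′)            ≡⟨ reflection k (tail g) Q a′ j′ (half-positive 0<j) j′<P a′+j′≡M ⟩
    neg (paper (tail g) a′)            ≡⟨ cong neg (sym (paper-even g a′)) ⟩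
    neg (paper g (a′ + a′))            ∎
  where
    open ≡-Reasoning
    P = 2 ^ k
    M = Q * P
    shape : ∀ Q P j → Q * (2 * P) + (j + j) ≡ (Q * P + j) + (Q * P + j)
    shape = solve-∀
    regroup : ∀ a j → (a + j) + (a + j) ≡ (a + a) + (j + j)
    regroup = solve-∀
    j′<P : j′ < P
    j′<P = double-<-cancel (subst (j′ + j′ <_) (pow-suc k) j<2P)
    a′+j′≡M : a′ + j′ ≡ M
    a′+j′≡M = double-injective _ _ (trans (regroup a′ j′) a+j≡M+M)
... | even a′ | odd j′ | a+j≡M+M = ⊥-elim (double≢odd (Q * 2 ^ k) (a′ + j′) (sym (trans (regroup a′ j′) a+j≡M+M)))
  where
    regroup : ∀ a j → suc ((a + j) + (a + j)) ≡ (a + a) + suc (j + j)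
    regroup = solve-∀
... | odd a′ | even j′ | a+j≡M+M = ⊥-elim (double≢odd (Q * 2 ^ k) (a′ + j′) (sym (trans (regroup a′ j′) a+j≡M+M)))
  where
    regroup : ∀ a j → suc ((a + j) + (a + j)) ≡ suc (a + a) + (j + j)
    regroup = solve-∀

periodicity : ∀ k g Q R w → 0 < R → R < 2 ^ k →
              paper g (Q * 2 ^ k + R + w * 2 ^ suc k) ≡ paper g (Q * 2 ^ k + R)
periodicity zero g Q (suc R) w _ (s≤s ())
periodicity (suc k) g Q R w 0<R R<2P with evenOdd R
... | odd r =
  begin
    paper g (Q * (2 * P) + suc (r + r) + w * (2 * (2 * P))) ≡⟨ cong (paper g) (shape-far Q P r w) ⟩
    paper g (suc (y + y) + 4 * (w * P))                     ≡⟨ odd-periodic g y (w * P) ⟩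
    paper g (suc (y + y))                                   ≡⟨ cong (paper g) (sym (shape-near Q P r)) ⟩
    paper g (Q * (2 * P) + suc (r + r))                     ∎
  where
    open ≡-Reasoning
    P = 2 ^ k
    y = Q * P + r
    shape-far : ∀ Q P r w → Q * (2 * P) + suc (r + r) + w * (2 * (2 * P)) ≡
                            suc ((Q * P + r) + (Q * P + r)) + 4 * (w * P)
    shape-far = solve-∀
    shape-near : ∀ Q P r → Q * (2 * P) + suc (r + r) ≡ suc ((Q * P + r) + (Q * P + r))
    shape-near = solve-∀
... | even r =
  begin
    paper g (Q * (2 * P) + (r + r) + w * (2 * (2 * P))) ≡⟨ cong (paper g) (shape-far Q P r w) ⟩
    paper g ((y + w * (2 * P)) + (y + w * (2 * P)))     ≡⟨ paper-even g (y + w * (2 * P)) ⟩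
    paper (tail g) (y + w * (2 * P))                    ≡⟨ periodicity k (tail g) Q r w (half-positive 0<R) r<P ⟩
    paper (tail g) y                                    ≡⟨ sym (paper-even g y) ⟩
    paper g (y + y)                                     ≡⟨ cong (paper g) (sym (shape-near Q P r)) ⟩
    paper g (Q * (2 * P) + (r + r))                     ∎
  where
    open ≡-Reasoning
    P = 2 ^ k
    y = Q * P + r
    shape-far : ∀ Q P r w → Q * (2 * P) + (r + r) + w * (2 * (2 * P)) ≡
                            (Q * P + r + w * (2 * P)) + (Q * P + r + w * (2 * P))
    shape-far = solve-∀
    shape-near : ∀ Q P r → Q * (2 * P) + (r + r) ≡ (Q * P + r) + (Q * P + r)
    shape-near = solve-∀
    r<P : r < P
    r<P = double-<-cancel (subst (r + r <_) (pow-suc k) R<2P)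
Mirrored : ℕ → ℕ → ℕ → ℕ → ℕ → Set
Mirrored k M w i i′ = i + i′ ≡ M + M + w * 2 ^ suc k

-- Left of the centre: reflect through M, then shift by the period.
mirror-below : ∀ k g Q w i i′ → let M = suc Q * 2 ^ k in
               Mirrored k M w i i′ → i < M → M < i + 2 ^ k → paper g i′ ≡ neg (paper g i)
mirror-below k g Q w i i′ mirrored i<M M<i+P with m≤n⇒∃[o]m+o≡n i<M
... | j , i+j≡M =
  begin
    paper g i′                 ≡⟨ cong (paper g) i′≡M+j+W ⟩
    paper g (M + suc j + W)    ≡⟨ periodicity k g (suc Q) (suc j) w (s≤s z≤n) j<P ⟩
    paper g (M + suc j)        ≡⟨ reflection k g (suc Q) i (suc j) (s≤s z≤n) j<P (trans (+-suc i j) i+j≡M) ⟩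
    neg (paper g i)            ∎
  where
    open ≡-Reasoning
    P = 2 ^ k
    M = suc Q * P
    W = w * 2 ^ suc k
    j<P : suc j < P
    j<P = +-cancelˡ-< i (suc j) P (subst (_< i + P) (sym (trans (+-suc i j) i+j≡M)) M<i+P)
    regroup : ∀ i j M W → (suc i + j) + M + W ≡ i + (M + suc j + W)
    regroup = solve-∀
    i′≡M+j+W : i′ ≡ M + suc j + W
    i′≡M+j+W = +-cancelˡ-≡ i _ _
      (trans mirrored (trans (cong (λ m → m + M + W) (sym i+j≡M)) (regroup i j M W)))

-- Right of the centre: reflect through M, then shift by the period.
mirror-above : ∀ k g Q w i i′ → let M = suc Q * 2 ^ k in
               Mirrored k M w i i′ → M < i → i < M + 2 ^ k → paper g i′ ≡ neg (paper g i)
mirror-above k g Q w i i′ mirrored M<i i<M+P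
  with m≤n⇒∃[o]m+o≡n M<i
... | j , M+j≡i with m≤n⇒∃[o]m+o≡n (+-cancelˡ-< (suc Q * 2 ^ k) (suc j) (2 ^ k)
         (subst (_< suc Q * 2 ^ k + 2 ^ k) (sym (trans (+-suc _ j) M+j≡i)) i<M+P))
... | r , j+r≡P =
  begin
    paper g i′                       ≡⟨ cong (paper g) i′≡QP+r+W ⟩
    paper g (Q * P + suc r + W)      ≡⟨ periodicity k g Q (suc r) w (s≤s z≤n) r<P ⟩
    paper g (Q * P + suc r)          ≡⟨ neg-swap (reflection k g (suc Q) (Q * P + suc r) (suc j) (s≤s z≤n) j<P below) ⟩
    neg (paper g (M + suc j))        ≡⟨ cong (λ n → neg (paper g n)) (trans (+-suc M j) M+j≡i) ⟩
    neg (paper g i)                  ∎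
  where
    open ≡-Reasoning
    P = 2 ^ k
    M = suc Q * P
    W = w * 2 ^ suc k
    j<P : suc j < P
    j<P = subst (suc j <_) j+r≡P (s≤s (s≤s (m≤m+n j r)))
    r<P : suc r < P
    r<P = subst (suc r <_) j+r≡P (s≤s (s≤s (m≤n+m r j)))
    below : Q * P + suc r + suc j ≡ M
    below = trans (swap (Q * P) r j) (cong (_+ Q * P) j+r≡P)
      where
        swap : ∀ x r j → x + suc r + suc j ≡ suc (suc j) + r + x
        swap = solve-∀
    regroup : ∀ M j Q P r W → (suc M + j) + (Q * P + suc r + W) ≡ M + (suc (suc j) + r + Q * P) + W
    regroup = solve-∀
    i′≡QP+r+W : i′ ≡ Q * P + suc r + W
    i′≡QP+r+W = +-cancelˡ-≡ i _ _ (trans mirrored (sym (trans (cong (_+ (Q * P + suc r + W)) (sym M+j≡i))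
      (trans (regroup M j Q P r W) (cong (λ p → M + (p + Q * P) + W) j+r≡P)))))

mirror : ∀ k g Q → let M = suc Q * 2 ^ k in ∃ λ w → w ≤ 3 ×
         (∀ i i′ → Mirrored k M w i i′ → M < i + 2 ^ k → i < M + 2 ^ k → paper g i′ ≡ neg (paper g i))
mirror k g Q with opposite-at-multiple k g (suc Q)
... | w , w≤3 , opposite = w , w≤3 , mirrored
  where
    M = suc Q * 2 ^ k
    mirrored : ∀ i i′ → Mirrored k M w i i′ → M < i + 2 ^ k → i < M + 2 ^ k → paper g i′ ≡ neg (paper g i)
    mirrored i i′ m lo hi with <-cmp i M
    ... | tri< i<M _ _ = mirror-below k g Q w i i′ m i<M lo
    ... | tri> _ _ M<i = mirror-above k g Q w i i′ m M<i hi
    ... | tri≈ _ refl _ = trans (cong (paper g) (+-cancelˡ-≡ M _ _ (trans m (+-assoc M M _)))) opposite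

segment : (ℕ → Sign) → ℕ → ℕ → List Sign
segment f p zero    = []
segment f p (suc m) = f (suc p) ∷ segment f (suc p) m

length-segment : ∀ f p m → length (segment f p m) ≡ m
length-segment f p zero    = refl
length-segment f p (suc m) = cong suc (length-segment f (suc p) m)

segment-snoc : ∀ f p m → segment f p (suc m) ≡ segment f p m ++ [ f (p + suc m) ]
segment-snoc f p zero    = cong (λ n → [ f n ]) (sym (+-comm p 1))
segment-snoc f p (suc m) =
  cong (f (suc p) ∷_) (trans (segment-snoc f (suc p) m) (cong (λ n → segment f (suc p) m ++ [ f n ]) (sym (+-suc p (suc m)))))

bar-snoc : ∀ xs x → bar (xs ++ [ x ]) ≡ neg x ∷ bar xs
bar-snoc xs x = trans (cong reverse (map-++ neg xs [ x ])) (reverse-++ (map neg xs) [ neg x ])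

segment-mirror : ∀ f C p q L → q + suc (p + L) ≡ C →
                 (∀ i i′ → i + i′ ≡ C → p < i → i ≤ p + L → f i′ ≡ neg (f i)) →
                 segment f q L ≡ bar (segment f p L)
segment-mirror f C p q zero    _     _     = refl
segment-mirror f C p q (suc L) q+p+L≡C mirrored =
  begin
    f (suc q) ∷ segment f (suc q) L                ≡⟨ cong₂ _∷_ head tail′ ⟩
    neg (f (p + suc L)) ∷ bar (segment f p L)      ≡⟨ sym (bar-snoc (segment f p L) (f (p + suc L))) ⟩
    bar (segment f p L ++ [ f (p + suc L) ])       ≡⟨ cong bar (sym (segment-snoc f p L)) ⟩
    bar (segment f p (suc L))                      ∎
  where
    open ≡-Reasoning
    outer : ∀ p L q → (p + suc L) + suc q ≡ q + suc (p + suc L)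
    outer = solve-∀
    inner : ∀ p L q → suc q + suc (p + L) ≡ q + suc (p + suc L)
    inner = solve-∀
    head : f (suc q) ≡ neg (f (p + suc L))
    head = mirrored (p + suc L) (suc q) (trans (outer p L q) q+p+L≡C) (m<m+n p (s≤s z≤n)) ≤-refl
    tail′ : segment f (suc q) L ≡ bar (segment f p L)
    tail′ = segment-mirror f C p (suc q) L (trans (inner p L q) q+p+L≡C)
      (λ i i′ e lo hi → mirrored i i′ e lo (≤-trans hi (+-monoʳ-≤ p (n≤1+n L))))

mirror-offset : ∀ P Q r L w → r < P → L < P → w ≤ 3 → ∃ λ q →
  q + suc (r + Q * P + L) ≡ suc Q * P + suc Q * P + w * (2 * P) ×
  r + Q * P < q + L × q + L ≤ r + Q * P + 8 * P
mirror-offset P Q r L w r<P L<P w≤3 with m≤n⇒∃[o]m+o≡n r<P | m≤n⇒∃[o]m+o≡n L<P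
... | r′ , r+r′≡P | l′ , L+l′≡P = q , sum , below , above
  where
    M = suc Q * P
    W = w * (2 * P)
    q = Q * P + r′ + suc l′ + W
    sum : q + suc (r + Q * P + L) ≡ M + M + W
    sum = trans (regroup Q P r r′ l′ L W) (cong₂ (λ a b → a + Q * P + (b + Q * P) + W) r+r′≡P L+l′≡P)
      where
        regroup : ∀ Q P r r′ l′ L W → (Q * P + r′ + suc l′ + W) + suc ((r + Q * P) + L) ≡
                  suc r + r′ + Q * P + (suc L + l′ + Q * P) + W
        regroup = solve-∀
    q+L≡M+r′+W : q + L ≡ M + (r′ + W)
    q+L≡M+r′+W = trans (regroup Q P r′ l′ L W) (cong (λ n → n + Q * P + (r′ + W)) L+l′≡P)
      where
        regroup : ∀ Q P r′ l′ L W → Q * P + r′ + suc l′ + W + L ≡ suc L + l′ + Q * P + (r′ + W)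
        regroup = solve-∀
    below : r + Q * P < q + L
    below = <-≤-trans (+-monoˡ-< (Q * P) r<P) (subst (M ≤_) (sym q+L≡M+r′+W) (m≤m+n M (r′ + W)))
    above : q + L ≤ r + Q * P + 8 * P
    above = begin
      q + L                        ≡⟨ q+L≡M+r′+W ⟩
      M + (r′ + W)                 ≤⟨ +-monoʳ-≤ M (+-mono-≤ r′≤P (*-monoˡ-≤ (2 * P) w≤3)) ⟩
      M + (P + 3 * (2 * P))        ≡⟨ regroup Q P ⟩
      Q * P + 8 * P                ≤⟨ +-monoˡ-≤ (8 * P) (m≤n+m (Q * P) r) ⟩
      r + Q * P + 8 * P            ∎
      where
        open ≤-Reasoning
        r′≤P : r′ ≤ P
        r′≤P = subst (r′ ≤_) r+r′≡P (m≤n+m r′ (suc r))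
        regroup : ∀ Q P → suc Q * P + (P + 3 * (2 * P)) ≡ Q * P + 8 * P
        regroup = solve-∀

within-radius : ∀ P Q r L i → r < P → L < P → r + Q * P < i → i ≤ r + Q * P + L →
                suc Q * P < i + P × i < suc Q * P + P
within-radius P Q r L i r<P L<P p<i i≤p+L =
  subst (suc Q * P <_) (+-comm P i) (+-monoʳ-< P (≤-<-trans (m≤n+m (Q * P) r) p<i)) ,
  ≤-<-trans i≤p+L (+-mono-< (+-monoˡ-< (Q * P) r<P) L<P)

OverlineNear : (ℕ → Sign) → ℕ → ℕ → Set
OverlineNear f L p = ∃ λ q → p < q + L × q + L ≤ p + 8 * 2 ^ L × segment f q L ≡ bar (segment f p L)

overline-near-aligned : ∀ g L Q r → r < 2 ^ L → OverlineNear (paper g) L (r + Q * 2 ^ L)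
overline-near-aligned g L Q r r<P with mirror L g Q
... | w , w≤3 , mirrored with mirror-offset (2 ^ L) Q r L w r<P (n<2^n L) w≤3
... | q , sum , below , above = q , below , above ,
  segment-mirror (paper g) _ (r + Q * 2 ^ L) q L sum (λ i i′ e lo hi →
    let close = within-radius (2 ^ L) Q r L i r<P (n<2^n L) lo hi in mirrored i i′ e (proj₁ close) (proj₂ close))

overline-near : ∀ g L p → OverlineNear (paper g) L p
overline-near g L p = subst (OverlineNear (paper g) L) (sym (m≡m%n+[m/n]*n p (2 ^ L)))
  (overline-near-aligned g L (p / 2 ^ L) (p % 2 ^ L) (m%n<n p (2 ^ L)))
  where
    instance
      2^L≢0 : NonZero (2 ^ L)
      2^L≢0 = m^n≢0 2 L
record Antipodal (f : ℕ → Sign) (x y m : ℕ) : Set where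
  constructor antipodal
  field at : ∀ t → t < m → f (y + t) ≡ neg (f (x + t))
open Antipodal

antipodal-sym : ∀ {f x y m} → Antipodal f x y m → Antipodal f y x m
antipodal-sym opposite = antipodal λ t t<m → neg-swap (at opposite t t<m)

antipodal-weaken : ∀ {f x y m n} → n ≤ m → Antipodal f x y m → Antipodal f x y n
antipodal-weaken n≤m opposite = antipodal λ t t<n → at opposite t (≤-trans t<n n≤m)

antipodal-step : ∀ {f x y m} → Antipodal f x y (suc m) → Antipodal f (suc x) (suc y) m
antipodal-step {f} {x} {y} opposite = antipodal λ t t<m →
  subst₂ (λ i j → f i ≡ neg (f j)) (+-suc y t) (+-suc x t) (at opposite (suc t) (s≤s t<m))

antipodal-half : ∀ g x y m → Antipodal (paper g) (x + x) (y + y) (suc (m + m)) →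
                 Antipodal (paper (tail g)) x y (suc m)
antipodal-half g x y m opposite = antipodal λ t t≤m →
  begin
    paper (tail g) (y + t)            ≡⟨ sym (paper-even g (y + t)) ⟩
    paper g ((y + t) + (y + t))       ≡⟨ cong (paper g) (regroup y t) ⟩
    paper g (y + y + (t + t))         ≡⟨ at opposite (t + t) (s≤s (+-mono-≤ (≤-pred t≤m) (≤-pred t≤m))) ⟩
    neg (paper g (x + x + (t + t)))   ≡⟨ cong (λ n → neg (paper g n)) (sym (regroup x t)) ⟩
    neg (paper g ((x + t) + (x + t))) ≡⟨ cong neg (paper-even g (x + t)) ⟩
    neg (paper (tail g) (x + t))      ∎
  where
    open ≡-Reasoning
    regroup : ∀ x t → (x + t) + (x + t) ≡ x + x + (t + t)
    regroup = solve-∀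

alternating-run-stays : ∀ (f : ℕ → Sign) n c → (∀ t → t < 4 → f (n + t) ≡ alternate c t) →
                        ∀ s → s < 2 → f (n + s + 2) ≡ f (n + s)
alternating-run-stays f n c run s s<2 =
  begin
    f (n + s + 2)          ≡⟨ cong f (+-assoc n s 2) ⟩
    f (n + (s + 2))        ≡⟨ run (s + 2) (+-monoˡ-< 2 s<2) ⟩
    alternate c (s + 2)    ≡⟨ alternate-+ c s 2 ⟩
    alternate (alternate c s) 2 ≡⟨ alternate-double (alternate c s) 1 ⟩
    alternate c s          ≡⟨ sym (run s (<-trans s<2 (s≤s (s≤s (s≤s z≤n))))) ⟩
    f (n + s)              ∎
  where open ≡-Reasoning

odd-not-2-periodic : ∀ g k → paper g (suc (k + k) + 2) ≡ paper g (suc (k + k)) → ⊥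
odd-not-2-periodic g k e = s≢neg-s (trans (sym e) (antiperiod-odd g k))

no-alternating-run : ∀ g n c → (∀ t → t < 4 → paper g (n + t) ≡ alternate c t) → ⊥
no-alternating-run g n c run with evenOdd n | alternating-run-stays (paper g) n c run
... | odd k  | stays = odd-not-2-periodic g k
  (subst (λ m → paper g (m + 2) ≡ paper g m) (+-identityʳ (suc (k + k))) (stays 0 (s≤s z≤n)))
... | even k | stays = odd-not-2-periodic g k
  (subst (λ m → paper g (m + 2) ≡ paper g m) (+-comm (k + k) 1) (stays 1 (s≤s (s≤s z≤n))))

-- An antipodal pair of length 7 starting at positions of different parity is impossible:
-- the even positions on one side mirror the alternating odd positions on the other,
-- so one level up the sequence would alternate on four consecutive positions.
mixed-parity : ∀ g a b → Antipodal (paper g) (a + a) (suc (b + b)) 7 → ⊥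
mixed-parity g a b opposite = no-alternating-run (tail g) a (neg (alternate (g 0) b)) run
  where
    run : ∀ s → s < 4 → paper (tail g) (a + s) ≡ alternate (neg (alternate (g 0) b)) s
    run s s<4 =
      begin
        paper (tail g) (a + s)                        ≡⟨ sym (paper-even g (a + s)) ⟩
        paper g ((a + s) + (a + s))                   ≡⟨ cong (paper g) (regroup a s) ⟩
        paper g (a + a + (s + s))                     ≡⟨ neg-swap (at opposite (s + s) s+s<7) ⟩
        neg (paper g (suc (b + b) + (s + s)))          ≡⟨ cong (λ n → neg (paper g n)) (regroup′ b s) ⟩
        neg (paper g (suc ((b + s) + (b + s))))        ≡⟨ cong neg (paper-odd g (b + s)) ⟩
        neg (alternate (g 0) (b + s))                 ≡⟨ cong neg (alternate-+ (g 0) b s) ⟩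
        neg (alternate (alternate (g 0) b) s)         ≡⟨ sym (alternate-neg (alternate (g 0) b) s) ⟩
        alternate (neg (alternate (g 0) b)) s         ∎
      where
        open ≡-Reasoning
        regroup : ∀ a s → (a + s) + (a + s) ≡ a + a + (s + s)
        regroup = solve-∀
        regroup′ : ∀ b s → suc (b + b) + (s + s) ≡ suc ((b + s) + (b + s))
        regroup′ = solve-∀
        s+s<7 : s + s < 7
        s+s<7 = s≤s (+-mono-≤ (≤-pred s<4) (≤-pred s<4))

-- An antipodal pair of length 7 whose start indices a, b sit at opposite parities of an
-- alternating sequence has start positions of mixed parity, which is impossible.
opposite-parity : ∀ g c a b → alternate c b ≡ neg (alternate c a) → Antipodal (paper g) a b 7 → ⊥
opposite-parity g c a b differ opposite with evenOdd a | evenOdd b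
... | even a′ | odd b′  = mixed-parity g a′ b′ opposite
... | odd a′  | even b′ = mixed-parity g b′ a′ (antipodal-sym opposite)
... | even a′ | even b′ = s≢neg-s (trans (sym (alternate-double c b′)) (trans differ (cong neg (alternate-double c a′))))
... | odd a′  | odd b′  = s≢neg-s (trans (sym (alternate-odd c b′)) (trans differ (cong neg (alternate-odd c a′))))

antipodal-odd-start : ∀ g a b → Antipodal (paper g) (suc (a + a)) (suc (b + b)) 1 →
                      alternate (g 0) b ≡ neg (alternate (g 0) a)
antipodal-odd-start g a b opposite =
  begin
    alternate (g 0) b                 ≡⟨ sym (paper-odd g b) ⟩
    paper g (suc (b + b))             ≡⟨ cong (paper g) (sym (+-identityʳ (suc (b + b)))) ⟩
    paper g (suc (b + b) + 0)         ≡⟨ at opposite 0 (s≤s z≤n) ⟩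
    neg (paper g (suc (a + a) + 0))   ≡⟨ cong (λ n → neg (paper g n)) (+-identityʳ (suc (a + a))) ⟩
    neg (paper g (suc (a + a)))       ≡⟨ cong neg (paper-odd g a) ⟩
    neg (alternate (g 0) a)           ∎
  where open ≡-Reasoning

-- No paperfolding sequence contains a segment of length 14 together with its negative:
-- with mixed parities this is mixed-parity; with equal parities the odd positions
-- force opposite parities one level up, where the even positions form a pair of length 7.
no-antipodal-pair : ∀ g x y → Antipodal (paper g) x y 14 → ⊥
no-antipodal-pair g x y opposite with evenOdd x | evenOdd y
... | even a | odd b  = mixed-parity g a b (antipodal-weaken (m≤m+n 7 7) opposite)
... | odd a  | even b = mixed-parity g b a (antipodal-weaken (m≤m+n 7 7) (antipodal-sym opposite))
... | even a | even b = opposite-parity (tail g) (g 0) a b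
  (antipodal-odd-start g a b (antipodal-weaken (s≤s z≤n) (antipodal-step opposite)))
  (antipodal-half g a b 6 (antipodal-weaken (n≤1+n 13) opposite))
... | odd a  | odd b  = opposite-parity (tail g) (g 0) (suc a) (suc b)
  (cong neg (antipodal-odd-start g a b (antipodal-weaken (s≤s z≤n) opposite)))
  (antipodal-half g (suc a) (suc b) 6
    (subst₂ (λ i j → Antipodal (paper g) i j 13) (double-suc a) (double-suc b) (antipodal-step opposite)))
  where
    double-suc : ∀ n → suc (suc (n + n)) ≡ suc n + suc n
    double-suc n = cong suc (sym (+-suc n n))
interleave : {A : Set} → List A → List A → List A
interleave []       ys = ys
interleave (x ∷ xs) ys = x ∷ interleave ys xs

alternating : Sign → ℕ → List Sign
alternating c zero    = []
alternating c (suc m) = c ∷ alternating (neg c) m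

length-bar : ∀ u → length (bar u) ≡ length u
length-bar u = trans (length-reverse (map neg u)) (length-map neg u)

length-alternating : ∀ c m → length (alternating c m) ≡ m
length-alternating c zero    = refl
length-alternating c (suc m) = cong suc (length-alternating (neg c) m)

interleave-++ : {A : Set} (xs ys xs′ ys′ : List A) → length xs ≡ suc (length ys) →
                interleave (xs ++ xs′) (ys ++ ys′) ≡ interleave xs ys ++ interleave ys′ xs′
interleave-++ (x ∷ [])     []       xs′ ys′ _ = refl
interleave-++ (x ∷ x′ ∷ xs) []      xs′ ys′ ()
interleave-++ (x ∷ xs)     (y ∷ ys) xs′ ys′ e =
  cong (λ zs → x ∷ y ∷ zs) (interleave-++ xs ys xs′ ys′ (suc-injective e))

map-interleave : {A B : Set} (f : A → B) (xs ys : List A) →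
                 map f (interleave xs ys) ≡ interleave (map f xs) (map f ys)
map-interleave f []       ys = refl
map-interleave f (x ∷ xs) ys = cong (f x ∷_) (map-interleave f ys xs)

reverse-interleave : {A : Set} (xs ys : List A) → length xs ≡ suc (length ys) →
                     reverse (interleave xs ys) ≡ interleave (reverse xs) (reverse ys)
reverse-interleave (x ∷ [])      []       _ = refl
reverse-interleave (x ∷ x′ ∷ xs) []       ()
reverse-interleave (x ∷ xs)      (y ∷ ys) e =
  begin
    reverse (x ∷ y ∷ interleave xs ys)                 ≡⟨ unfold-reverse x (y ∷ interleave xs ys) ⟩
    reverse (y ∷ interleave xs ys) ++ [ x ]            ≡⟨ cong (_++ [ x ]) (unfold-reverse y (interleave xs ys)) ⟩
    (reverse (interleave xs ys) ++ [ y ]) ++ [ x ]     ≡⟨ ++-assoc (reverse (interleave xs ys)) [ y ] [ x ] ⟩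
    reverse (interleave xs ys) ++ interleave [ y ] [ x ] ≡⟨ cong (_++ interleave [ y ] [ x ]) (reverse-interleave xs ys e′) ⟩
    interleave (reverse xs) (reverse ys) ++ interleave [ y ] [ x ]
      ≡⟨ sym (interleave-++ (reverse xs) (reverse ys) [ x ] [ y ] (trans (length-reverse xs) (trans e′ (cong suc (sym (length-reverse ys)))))) ⟩
    interleave (reverse xs ++ [ x ]) (reverse ys ++ [ y ]) ≡⟨ sym (cong₂ interleave (unfold-reverse x xs) (unfold-reverse y ys)) ⟩
    interleave (reverse (x ∷ xs)) (reverse (y ∷ ys))    ∎
  where
    open ≡-Reasoning
    e′ = suc-injective e

bar-interleave : ∀ xs ys → length xs ≡ suc (length ys) → bar (interleave xs ys) ≡ interleave (bar xs) (bar ys)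
bar-interleave xs ys e = trans (cong reverse (map-interleave neg xs ys))
  (reverse-interleave (map neg xs) (map neg ys) (trans (length-map neg xs) (trans e (cong suc (sym (length-map neg ys))))))

-- The overline of an alternating list is alternating, and an alternating list preceded
-- by its overline is again alternating: this is the folding step on the odd places.
alternating-++ : ∀ c m j → alternating c m ++ alternating (alternate c m) j ≡ alternating c (m + j)
alternating-++ c zero    j = refl
alternating-++ c (suc m) j =
  cong (c ∷_) (trans (cong (λ d → alternating (neg c) m ++ alternating d j) (sym (alternate-neg c m)))
                     (alternating-++ (neg c) m j))

alternating-snoc : ∀ c m → alternating c (suc m) ≡ alternating c m ++ [ alternate c m ]
alternating-snoc c m = trans (cong (alternating c) (+-comm 1 m)) (sym (alternating-++ c m 1))

bar-alternating : ∀ c m → bar (alternating c m) ≡ alternating (alternate c m) m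
bar-alternating c zero    = refl
bar-alternating c (suc m) =
  begin
    reverse (neg c ∷ map neg (alternating (neg c) m))  ≡⟨ unfold-reverse (neg c) (map neg (alternating (neg c) m)) ⟩
    bar (alternating (neg c) m) ++ [ neg c ]           ≡⟨ cong (_++ [ neg c ]) (bar-alternating (neg c) m) ⟩
    alternating d m ++ [ neg c ]                       ≡⟨ cong (λ e → alternating d m ++ [ e ]) (sym d-returns) ⟩
    alternating d m ++ [ alternate d m ]               ≡⟨ sym (alternating-snoc d m) ⟩
    alternating d (suc m)                              ≡⟨ cong (λ e → alternating e (suc m)) (alternate-neg c m) ⟩
    alternating (alternate c (suc m)) (suc m)          ∎
  where
    open ≡-Reasoning
    d = alternate (neg c) m
    d-returns : alternate d m ≡ neg c
    d-returns = trans (sym (alternate-+ (neg c) m m)) (alternate-double (neg c) m)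

bar-alternating-++ : ∀ c m → bar (alternating c m) ++ alternating c m ≡ alternating (alternate c m) (m + m)
bar-alternating-++ c m =
  begin
    bar (alternating c m) ++ alternating c m             ≡⟨ cong (_++ alternating c m) (bar-alternating c m) ⟩
    alternating d m ++ alternating c m                   ≡⟨ cong (λ e → alternating d m ++ alternating e m) (sym d-returns) ⟩
    alternating d m ++ alternating (alternate d m) m     ≡⟨ alternating-++ d m m ⟩
    alternating d (m + m)                                ∎
  where
    open ≡-Reasoning
    d = alternate c m
    d-returns : alternate d m ≡ c
    d-returns = trans (sym (alternate-+ c m m)) (alternate-double c m)

folding-structure : ∀ {n F} → Folding (suc n) F →
  ∃₂ λ c V → Folding n V × F ≡ interleave (alternating c (suc (length V))) V
folding-structure (fold-suc fold-zero s) = s , [] , fold-zero , refl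
folding-structure (fold-suc {U = U} foldU@(fold-suc _ _) s) with folding-structure foldU
... | c , V , foldV , U≡ = alternate c m , bar V ++ s ∷ V , fold-suc foldV s ,
  (begin
    bar U ++ s ∷ U                                      ≡⟨ cong (λ W → bar W ++ s ∷ W) U≡ ⟩
    bar (interleave A V) ++ s ∷ interleave A V          ≡⟨ cong (_++ s ∷ interleave A V) (bar-interleave A V |A|) ⟩
    interleave (bar A) (bar V) ++ interleave (s ∷ V) A  ≡⟨ sym (interleave-++ (bar A) (bar V) A (s ∷ V) |barA|) ⟩
    interleave (bar A ++ A) (bar V ++ s ∷ V)            ≡⟨ cong (λ B → interleave B (bar V ++ s ∷ V)) (bar-alternating-++ c m) ⟩
    interleave (alternating (alternate c m) (m + m)) (bar V ++ s ∷ V)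
      ≡⟨ cong (λ k → interleave (alternating (alternate c m) k) (bar V ++ s ∷ V)) m+m≡ ⟩
    interleave (alternating (alternate c m) (suc (length (bar V ++ s ∷ V)))) (bar V ++ s ∷ V) ∎)
  where
    open ≡-Reasoning
    m = suc (length V)
    A = alternating c m
    |A| : length A ≡ suc (length V)
    |A| = length-alternating c m
    |barA| : length (bar A) ≡ suc (length (bar V))
    |barA| = trans (length-bar A) (trans |A| (cong suc (sym (length-bar V))))
    m+m≡ : m + m ≡ suc (length (bar V ++ s ∷ V))
    m+m≡ = cong suc (trans (cong (_+ m) (sym (length-bar V))) (sym (length-++ (bar V))))

interleave-segment : ∀ g a m →
  interleave (alternating (alternate (g 0) a) (suc m)) (segment (paper (tail g)) a m) ≡
  segment (paper g) (a + a) (suc (m + m))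
interleave-segment g a zero    = cong [_] (sym (paper-odd g a))
interleave-segment g a (suc m) =
  begin
    alternate (g 0) a ∷ paper (tail g) (suc a) ∷
      interleave (alternating (alternate (g 0) (suc a)) (suc m)) (segment (paper (tail g)) (suc a) m)
      ≡⟨ cong₂ (λ x xs → x ∷ paper (tail g) (suc a) ∷ xs) (sym (paper-odd g a)) (interleave-segment g (suc a) m) ⟩
    paper g (suc (a + a)) ∷ paper (tail g) (suc a) ∷ segment (paper g) (suc a + suc a) (suc (m + m))
      ≡⟨ cong₂ (λ x xs → paper g (suc (a + a)) ∷ x ∷ xs) (sym (paper-even g (suc a)))
               (cong₂ (segment (paper g)) (cong suc (+-suc a a)) (sym (+-suc m m))) ⟩
    paper g (suc (a + a)) ∷ paper g (suc a + suc a) ∷ segment (paper g) (suc (suc (a + a))) (m + suc m)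
      ≡⟨ cong (λ i → paper g (suc (a + a)) ∷ paper g i ∷ segment (paper g) (suc (suc (a + a))) (m + suc m)) (cong suc (+-suc a a)) ⟩
    segment (paper g) (a + a) (suc (suc m + suc m)) ∎
  where open ≡-Reasoning

folding-segment : ∀ {n F} → Folding n F → ∃ λ g → F ≡ segment (paper g) 0 (length F)
folding-segment fold-zero = (λ _ → plus) , refl
folding-segment {F = F} foldF@(fold-suc _ _) with folding-structure foldF
... | c , V , foldV , F≡ with folding-segment foldV
... | h , V≡ = g , trans F≡segment (cong (segment (paper g) 0) (sym (trans (cong length F≡segment) (length-segment (paper g) 0 _))))
  where
    g = c ◂ h
    F≡segment : F ≡ segment (paper g) 0 (suc (length V + length V))
    F≡segment = trans F≡ (trans (cong (interleave (alternating c (suc (length V)))) V≡)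
                                (interleave-segment g 0 (length V)))

length-window : ∀ S a m → length (window S a m) ≡ m
length-window S a zero    = refl
length-window S a (suc m) = cong suc (length-window S (a +ℤ + 1) m)

window-slice : ∀ S a t m k → take m (drop t (window S a (t + (m + k)))) ≡ window S (a +ℤ + t) m
window-slice S a zero    m k = trans (take-window a m) (cong (λ b → window S b m) (sym (ℤ.+-identityʳ a)))
  where
    take-window : ∀ a m → take m (window S a (m + k)) ≡ window S a m
    take-window a zero    = refl
    take-window a (suc m) = cong (S (a +ℤ + 1) ∷_) (take-window (a +ℤ + 1) m)
window-slice S a (suc t) m k =
  trans (window-slice S (a +ℤ + 1) t m k) (cong (λ b → window S b m) (ℤ.+-assoc a (+ 1) (+ t)))

segment-slice : ∀ f p t m k → take m (drop t (segment f p (t + (m + k)))) ≡ segment f (p + t) m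
segment-slice f p zero    m k = trans (take-segment p m) (cong (λ q → segment f q m) (sym (+-identityʳ p)))
  where
    take-segment : ∀ p m → take m (segment f p (m + k)) ≡ segment f p m
    take-segment p zero    = refl
    take-segment p (suc m) = cong (f (suc p) ∷_) (take-segment (suc p) m)
segment-slice f p (suc t) m k =
  trans (segment-slice f (suc p) t m k) (cong (λ q → segment f q m) (sym (+-suc p t)))

sub-window : ∀ S a f z N t m → window S a N ≡ segment f z N → t + m ≤ N →
             window S (a +ℤ + t) m ≡ segment f (z + t) m
sub-window S a f z N t m agree t+m≤N with m≤n⇒∃[o]m+o≡n t+m≤N
... | k , t+m+k≡N =
  begin
    window S (a +ℤ + t) m                          ≡⟨ sym (window-slice S a t m k) ⟩
    take m (drop t (window S a (t + (m + k))))     ≡⟨ cong (take m ∘ drop t) agree′ ⟩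
    take m (drop t (segment f z (t + (m + k))))    ≡⟨ segment-slice f z t m k ⟩
    segment f (z + t) m                            ∎
  where
    open ≡-Reasoning
    agree′ : window S a (t + (m + k)) ≡ segment f z (t + (m + k))
    agree′ = subst (λ n → window S a n ≡ segment f z n) (sym (trans (sym (+-assoc t m k)) t+m+k≡N)) agree

window-in-paper : ∀ S → CompleteFolding S → ∀ a N → ∃₂ λ g z → window S a N ≡ segment (paper g) z N
window-in-paper S cf a N with cf (window S a N) (a , cong (window S a) (length-window S a N))
... | n , F , foldF , z , z+|W|≤|F| , taken with folding-segment foldF | m≤n⇒∃[o]m+o≡n z+|W|≤|F|
... | g , F≡ | k , z+|W|+k≡|F| = g , z ,
  (begin
    W                                                        ≡⟨ sym taken ⟩
    take (length W) (drop z F)                               ≡⟨ cong (take (length W) ∘ drop z) F≡segment ⟩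
    take (length W) (drop z (segment (paper g) 0 (z + (length W + k)))) ≡⟨ segment-slice (paper g) 0 z (length W) k ⟩
    segment (paper g) z (length W)                           ≡⟨ cong (segment (paper g) z) (length-window S a N) ⟩
    segment (paper g) z N                                    ∎)
  where
    open ≡-Reasoning
    W = window S a N
    F≡segment : F ≡ segment (paper g) 0 (z + (length W + k))
    F≡segment = trans F≡ (cong (segment (paper g) 0) (sym (trans (sym (+-assoc z (length W) k)) z+|W|+k≡|F|)))

map-neg-involutive : ∀ u → map neg (map neg u) ≡ u
map-neg-involutive []      = refl
map-neg-involutive (s ∷ u) = cong₂ _∷_ (neg-involutive s) (map-neg-involutive u)

bar-involutive : ∀ u → bar (bar u) ≡ u
bar-involutive u =
  begin
    reverse (map neg (reverse (map neg u)))  ≡⟨ cong reverse (reverse-map neg (map neg u)) ⟩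
    reverse (reverse (map neg (map neg u)))  ≡⟨ reverse-involutive (map neg (map neg u)) ⟩
    map neg (map neg u)                      ≡⟨ map-neg-involutive u ⟩
    u                                        ∎
  where open ≡-Reasoning

window-snoc : ∀ S a m → window S a (suc m) ≡ window S a m ++ [ S (a +ℤ + suc m) ]
window-snoc S a zero    = refl
window-snoc S a (suc m) = cong (S (a +ℤ + 1) ∷_)
  (trans (window-snoc S (a +ℤ + 1) m) (cong (λ b → window S (a +ℤ + 1) m ++ [ S b ]) (ℤ.+-assoc a (+ 1) (+ suc m))))

window-barZ : ∀ S h m → window (barZ S) h m ≡ bar (window S (- (h +ℤ + suc m)) m)
window-barZ S h zero    = refl
window-barZ S h (suc m) =
  begin
    neg (S (- (h +ℤ + 1))) ∷ window (barZ S) (h +ℤ + 1) m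
      ≡⟨ cong (neg (S (- (h +ℤ + 1))) ∷_) (window-barZ S (h +ℤ + 1) m) ⟩
    neg (S (- (h +ℤ + 1))) ∷ bar (window S (- ((h +ℤ + 1) +ℤ + suc m)) m)
      ≡⟨ cong₂ (λ i b → neg (S i) ∷ bar (window S b m)) (sym (last-position h (+ 1) (+ suc m)))
               (cong -_ (ℤ.+-assoc h (+ 1) (+ suc m))) ⟩
    neg (S (b +ℤ + suc m)) ∷ bar (window S b m)    ≡⟨ sym (bar-snoc (window S b m) (S (b +ℤ + suc m))) ⟩
    bar (window S b m ++ [ S (b +ℤ + suc m) ])     ≡⟨ cong bar (sym (window-snoc S b m)) ⟩
    bar (window S b (suc m))                       ∎
  where
    open ≡-Reasoning
    b = - (h +ℤ + suc (suc m))
    last-position : ∀ h x y → - (h +ℤ (x +ℤ y)) +ℤ y ≡ - (h +ℤ x)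
    last-position = ℤ-solve-∀

barZ-subword : ∀ S u → SubwordZ u (barZ S) → SubwordZ (bar u) S
barZ-subword S u (h , at-h) = - (h +ℤ + suc L) ,
  subst (λ n → window S (- (h +ℤ + suc L)) n ≡ bar u) (sym (length-bar u))
    (trans (sym (bar-involutive _)) (cong bar (trans (sym (window-barZ S h L)) at-h)))
  where L = length u

subword-barZ : ∀ S u → SubwordZ (bar u) S → SubwordZ u (barZ S)
subword-barZ S u (h , at-h) = h′ ,
  (begin
    window (barZ S) h′ L                  ≡⟨ window-barZ S h′ L ⟩
    bar (window S (- (h′ +ℤ + suc L)) L)  ≡⟨ cong (λ b → bar (window S b L)) (cancel h (+ suc L)) ⟩
    bar (window S h L)                    ≡⟨ cong bar (subst (λ n → window S h n ≡ bar u) (length-bar u) at-h) ⟩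
    bar (bar u)                           ≡⟨ bar-involutive u ⟩
    u                                     ∎)
  where
    open ≡-Reasoning
    L = length u
    h′ = - (h +ℤ + suc L)
    cancel : ∀ h s → - (- (h +ℤ s) +ℤ s) ≡ h
    cancel = ℤ-solve-∀

-- The set of subwords of a complete folding sequence is closed under overline: the window
-- of S around u is a segment of a paperfolding sequence, which contains the overline of u
-- close enough to u to lie in the same window.
bar-closed : ∀ S → CompleteFolding S → ∀ u → SubwordZ u S → SubwordZ (bar u) S
bar-closed S cf u (h , at-h) with window-in-paper S cf (h -ℤ + length u) (length u + 8 * 2 ^ length u)
... | g , z , block with overline-near g (length u) (z + length u)
... | q , z+L<q+L , q+L≤ , q-segment with m≤n⇒∃[o]m+o≡n (+-cancelʳ-< (length u) z q z+L<q+L)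
... | t , z+t≡q = (h -ℤ + L) +ℤ + suc t ,
  subst (λ n → window S ((h -ℤ + L) +ℤ + suc t) n ≡ bar u) (sym (length-bar u))
    (begin
      window S ((h -ℤ + L) +ℤ + suc t) L   ≡⟨ sub-window S _ (paper g) z _ (suc t) L block t+L≤ ⟩
      segment (paper g) (z + suc t) L      ≡⟨ cong (λ p → segment (paper g) p L) (trans (+-suc z t) z+t≡q) ⟩
      segment (paper g) q L                ≡⟨ q-segment ⟩
      bar (segment (paper g) (z + L) L)    ≡⟨ cong bar u-segment ⟩
      bar u                                ∎)
  where
    open ≡-Reasoning
    L = length u
    cancel : ∀ h x → (h -ℤ x) +ℤ x ≡ h
    cancel = ℤ-solve-∀
    L≤8P : L ≤ 8 * 2 ^ L
    L≤8P = ≤-trans (<⇒≤ (n<2^n L)) (m≤n*m (2 ^ L) 8)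
    u-segment : segment (paper g) (z + L) L ≡ u
    u-segment = trans (sym (sub-window S _ (paper g) z _ L L block (+-monoʳ-≤ L L≤8P)))
                      (trans (cong (λ b → window S b L) (cancel h (+ L))) at-h)
    t+L≤ : suc t + L ≤ L + 8 * 2 ^ L
    t+L≤ = +-cancelˡ-≤ z _ _ (subst₂ _≤_ (trans (cong (_+ L) (sym (trans (+-suc z t) z+t≡q))) (+-assoc z (suc t) L))
                                         (+-assoc z L (8 * 2 ^ L)) q+L≤)

locally-isomorphic-barZ : ∀ S → CompleteFolding S → LocallyIsomorphic S (barZ S)
locally-isomorphic-barZ S cf u =
  (λ in-S → subword-barZ S u (bar-closed S cf u in-S)) ,
  (λ in-barZ → subst (λ v → SubwordZ v S) (bar-involutive u) (bar-closed S cf (bar u) (barZ-subword S u in-barZ)))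

window-negZ : ∀ S h m → window (negZ S) h m ≡ map neg (window S h m)
window-negZ S h zero    = refl
window-negZ S h (suc m) = cong (neg (S (h +ℤ + 1)) ∷_) (window-negZ S (h +ℤ + 1) m)

two-windows-in-paper : ∀ S → CompleteFolding S → ∀ h m → ∃ λ g → ∃₂ λ x y →
  window S (+ 0) m ≡ segment (paper g) x m × window S h m ≡ segment (paper g) y m
two-windows-in-paper S cf (+ n) m with window-in-paper S cf (+ 0) (n + m)
... | g , z , block = g , z + 0 , z + n ,
  sub-window S (+ 0) (paper g) z (n + m) 0 m block (m≤n+m m n) ,
  sub-window S (+ 0) (paper g) z (n + m) n m block ≤-refl
two-windows-in-paper S cf -[1+ n ] m with window-in-paper S cf -[1+ n ] (suc n + m)
... | g , z , block = g , z + suc n , z + 0 ,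
  trans (cong (λ b → window S b m) (sym (ℤ.n⊖n≡0 (suc n)))) (sub-window S -[1+ n ] (paper g) z (suc n + m) (suc n) m block ≤-refl) ,
  trans (cong (λ b → window S b m) (sym (ℤ.+-identityʳ -[1+ n ]))) (sub-window S -[1+ n ] (paper g) z (suc n + m) 0 m block (m≤n+m m (suc n)))

segment-antipodal : ∀ f p q m → map neg (segment f p m) ≡ segment f q m → Antipodal f (suc p) (suc q) m
segment-antipodal f p q zero    _  = antipodal λ t ()
segment-antipodal f p q (suc m) eq = antipodal λ where
  zero    _         → subst₂ (λ i j → f i ≡ neg (f j)) (sym (+-identityʳ (suc q))) (sym (+-identityʳ (suc p)))
                             (sym (∷-injectiveˡ eq))
  (suc t) (s≤s t<m) → subst₂ (λ i j → f i ≡ neg (f j)) (sym (+-suc (suc q) t)) (sym (+-suc (suc p) t))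
                             (at (segment-antipodal f (suc p) (suc q) m (∷-injectiveʳ eq)) t t<m)

-- A complete folding sequence is not locally isomorphic to its negative: if the window of
-- length 14 at the origin occurred in -S, S would contain it together with its negative.
not-locally-isomorphic-negZ : ∀ S → CompleteFolding S → ¬ LocallyIsomorphic S (negZ S)
not-locally-isomorphic-negZ S cf iso
  with proj₁ (iso (window S (+ 0) 14)) (+ 0 , cong (window S (+ 0)) (length-window S (+ 0) 14))
... | h , at-h with two-windows-in-paper S cf h 14
... | g , x , y , at-0 , at-y = no-antipodal-pair g (suc y) (suc x) (segment-antipodal (paper g) y x 14
  (begin
    map neg (segment (paper g) y 14)  ≡⟨ cong (map neg) (sym at-y) ⟩
    map neg (window S h 14)           ≡⟨ sym (window-negZ S h 14) ⟩
    window (negZ S) h 14              ≡⟨ subst (λ n → window (negZ S) h n ≡ window S (+ 0) 14) (length-window S (+ 0) 14) at-h ⟩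
    window S (+ 0) 14                 ≡⟨ at-0 ⟩
    segment (paper g) x 14            ∎))
  where open ≡-Reasoning

corollary1p9 : (S : ZSeq) → CompleteFolding S →
    LocallyIsomorphic S (barZ S) × ¬ LocallyIsomorphic S (negZ S)
corollary1p9 S cf = locally-isomorphic-barZ S cf , not-locally-isomorphic-negZ S cf
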